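{- Let $n,m\in\mathbb{N}$ with $m\ge n$, and let $F_{n,m}$ be the flower graph whose central vertices are labeled $1,\dots,n$. For every integer $k$ with $0<k\le n$, the bicolored graph $\Phi_{1 2\cdots k}(F_{n,m})$ (obtained by applying the local homophily transformation successively at vertices $1,2,\dots,k$) satisfies: (1) each central vertex $i\le k$ has its color flipped (relative to its color in $F_{n,m}$); (2) for each $i<k$, vertex $i$ is adjacent to all vertices of the petal of vertex $i+1$; (3) the subgraph induced by $\{1,\dots,k\}$ is the path $P_k$; (4) for every $i<k$, vertex $i$ has no edge to any central vertex $j>k$; (5) the subgraph induced by $\{k,k+1,\dots,n\}$ is the complete graph $K_{n-k+1}$.
   Context: Graphs are finite, simple and undirected; $N_G(v)$ denotes the neighborhood of $v$ in $G$. A bicolored graph is a pair $B=(G,c)$ with $c:V(G)\to\{ -1,+1\}$. For $v\in V(G)$, the local homophily transformation at $v$ is $\Phi_v(B)=(G',c')$, where $c'(u)=c(u)$ for all $u\neq v$, and $c'(v)=\mathrm{sign}\left(\sum_{u\in N_G(v)}c(u)\right)$ if this sum is nonzero, and $c'(v)=c(v)$ otherwise. The graph $G'$ has the same vertex set as $G$; its edge set is obtained from that of $G$ by replacing the subgraph induced by $N_G(v)$ with the graph in which, for distinct $x,y\in N_G(v)$, $xy$ is an edge if and only if $c(x)=c(y)$ (colors taken before the update); all other edges are unchanged. For a word $w=v_1\cdots v_k$, $\Phi_w:=\Phi_{v_k}\circ\cdots\circ\Phi_{v_1}$. The flower graph $F_{n,m}$ is the bicolored graph consisting of a clique $K_n$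 (the center) whose vertices are all colored $+1$, together with, for each center vertex $v$, a disjoint clique $K_m^{(v)}$ (the petal of $v$) whose vertices are all colored $-1$, with $v$ adjacent to every vertex of $K_m^{(v)}$; there are no other edges. -}

module Defs where

open import Data.Bool using (Bool; true; false; _∧_; if_then_else_; not)
open import Data.Nat using (ℕ)
import Data.Nat as ℕ
import Data.Bool
open import Data.Integer using (ℤ; +_; +[1+_]; -[1+_]; _+_; 0ℤ)
import Data.Integer as ℤ
open import Data.Fin using (Fin; _↑ˡ_; _↑ʳ_; splitAt; combine; remQuot)
open import Data.List using (List; []; _∷_; foldr; allFin; take; map)
open import Data.Sum using (inj₁; inj₂)
open import Data.Product using (_,_)
open import Relation.Nullary using (does)

-- Bicolored graph on the vertex set Fin N.
-- adj x y = true iff xy is an edge; color true = +1, false = -1.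
record BG (N : ℕ) : Set where
  constructor mkBG
  field
    adj   : Fin N → Fin N → Bool
    color : Fin N → Bool
open BG public

_==_ : ∀ {N} → Fin N → Fin N → Bool
x == y = does (x Data.Fin.≟ y)

sameColor : Bool → Bool → Bool
sameColor a b = does (a Data.Bool.≟ b)

colorVal : Bool → ℤ
colorVal true  = + 1
colorVal false = ℤ.- (+ 1)

nbrSum : ∀ {N} → BG N → Fin N → ℤ
nbrSum B v = foldr (λ u acc → (if adj B v u then colorVal (color B u) else 0ℤ) + acc) 0ℤ (allFin _)

newColor : ℤ → Bool → Bool
newColor (+ ℕ.zero) c = c
newColor +[1+ _ ]   c = true
newColor -[1+ _ ]   c = false

Φ : ∀ {N} → Fin N → BG N → BG N
Φ {N} v B = mkBG adj' col'
  where
    inN : Fin N → Bool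
    inN x = adj B v x
    adj' : Fin N → Fin N → Bool
    adj' x y = if inN x ∧ inN y ∧ not (x == y)
               then sameColor (color B x) (color B y)
               else adj B x y
    col' : Fin N → Bool
    col' u = if u == v then newColor (nbrSum B v) (color B v) else color B u

Φw : ∀ {N} → List (Fin N) → BG N → BG N
Φw []      B = B
Φw (v ∷ w) B = Φw w (Φ v B)

-- Flower graph F_{n,m} on vertex set Fin (n + n * m):
-- center i ↦ i ↑ˡ (n * m), j-th vertex of petal of i ↦ n ↑ʳ combine i j
center : ∀ {n m} → Fin n → Fin (n ℕ.+ n ℕ.* m)
center {n} {m} i = i ↑ˡ (n ℕ.* m)

petal : ∀ {n m} → Fin n → Fin m → Fin (n ℕ.+ n ℕ.* m)
petal {n} {m} i j = n ↑ʳ combine i j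

flowerAdj : ∀ n m → Fin (n ℕ.+ n ℕ.* m) → Fin (n ℕ.+ n ℕ.* m) → Bool
flowerAdj n m x y with splitAt n x | splitAt n y
... | inj₁ i | inj₁ j = not (i == j)
... | inj₁ i | inj₂ q with remQuot {n} m q
...   | (j , _) = i == j
flowerAdj n m x y | inj₂ p | inj₁ j with remQuot {n} m p
...   | (i , _) = i == j
flowerAdj n m x y | inj₂ p | inj₂ q with remQuot {n} m p | remQuot {n} m q
...   | (i , a) | (j , b) = (i == j) ∧ not (a == b)

flowerColor : ∀ n m → Fin (n ℕ.+ n ℕ.* m) → Bool
flowerColor n m x with splitAt n x
... | inj₁ _ = true
... | inj₂ _ = false

flower : (n m : ℕ) → BG (n ℕ.+ n ℕ.* m)
flower n m = mkBG (flowerAdj n m) (flowerColor n m)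

-- the word 1 2 ⋯ k (center vertices, label ℓ ↦ Fin index ℓ - 1)
word1k : ∀ n m → ℕ → List (Fin (n ℕ.+ n ℕ.* m))
word1k n m k = map (center {n} {m}) (take k (allFin n))

{-# OPTIONS --safe #-}
module Submission where

-- Index the centers by Fin n, so that center i carries the label i + 1. After
-- the first k transformations the graph has an explicit description (IsStage k):
-- the processed centers i < k are recoloured -1, consecutive centers are
-- adjacent, the centers i ≥ k - 1 form a clique, center i is joined to its own
-- petal and, once i + 1 is processed, to the petal of i + 1, and the petals keep
-- their colour and their cliques. When center k is processed, its neighbourhood
-- consists of center k - 1 (colour -1), the centers after k (colour +1) and its
-- own petal (colour -1). Rewiring this neighbourhood by colour cuts k - 1 off
-- from the later centers, joins it to the petal of k and changes nothing else;
-- and since at most n - 1 neighbours have colour +1 while the m ≥ n petal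
-- vertices have colour -1, center k turns -1. The five claims are read off this
-- description.

open import Defs
open import Data.Bool using (Bool; true; false; not; _∧_; _∨_; if_then_else_)
import Data.Bool.Properties as BoolP
open import Data.Nat as ℕ using (ℕ; zero; suc; _≤_; _<_; _≤?_; _∸_)
import Data.Nat.Properties as ℕP
open import Data.Fin as Fin using (Fin; toℕ; _↑ˡ_; _↑ʳ_; splitAt; combine)
import Data.Fin.Properties as FinP
open import Data.Integer as ℤ using (ℤ; +_; -[1+_]; 0ℤ; -1ℤ; _+_; _⊖_)
import Data.Integer.Properties as ℤP
open import Data.List using (List; []; _∷_; _∷ʳ_; foldr; tabulate; map; take; allFin)
import Data.List.Properties as ListP
open import Data.Product using (_×_; _,_; proj₁; proj₂)
open import Data.Sum as Sum using (_⊎_; inj₁; inj₂; [_,_])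
open import Data.Vec.Functional using (removeAt)
open import Function using (_∘_; id; mk⇔)
open import Relation.Binary using (tri<; tri≈; tri>)
open import Relation.Binary.PropositionalEquality
  using (_≡_; _≢_; refl; sym; trans; cong; cong₂; subst; module ≡-Reasoning)
open import Relation.Nullary using (Dec; yes; no; does; ¬_; contradiction)
open import Relation.Nullary.Decidable using (dec-true; dec-false; does-⇔; _⊎-dec_)
open import Algebra.Properties.CommutativeMonoid.Sum ℤP.+-0-commutativeMonoid
  using (sum; sum-cong-≗; sum-replicate-zero; sum-remove; ∑-comm)

==-refl : ∀ {N} (x : Fin N) → (x == x) ≡ true
==-refl x = dec-true (x Fin.≟ x) refl

==-≢ : ∀ {N} {x y : Fin N} → x ≢ y → (x == y) ≡ false
==-≢ {x = x} {y} = dec-false (x Fin.≟ y)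

==-sym : ∀ {N} (x y : Fin N) → (x == y) ≡ (y == x)
==-sym x y with x Fin.≟ y
... | yes refl = sym (==-refl x)
... | no x≢y   = sym (==-≢ (x≢y ∘ sym))

==-toℕ : ∀ {N} {i j : Fin N} → toℕ i ≡ toℕ j → (i == j) ≡ true
==-toℕ {i = i} {j} eq = dec-true (i Fin.≟ j) (FinP.toℕ-injective eq)

==-toℕ-≢ : ∀ {N} {i j : Fin N} → toℕ i ≢ toℕ j → (i == j) ≡ false
==-toℕ-≢ neq = ==-≢ (neq ∘ cong toℕ)

sameColor-sym : ∀ a b → sameColor a b ≡ sameColor b a
sameColor-sym true  true  = refl
sameColor-sym true  false = refl
sameColor-sym false true  = refl
sameColor-sym false false = refl

does-true : ∀ {A : Set} (a? : Dec A) → does a? ≡ true → A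
does-true (yes a) _ = a

does-s≤s : ∀ a b → does (suc a ≤? suc b) ≡ does (a ≤? b)
does-s≤s a b = does-⇔ (mk⇔ ℕ.s≤s⁻¹ ℕ.s≤s) (suc a ≤? suc b) (a ≤? b)

does-n≤1+n : ∀ a → does (a ≤? suc a) ≡ true
does-n≤1+n a = dec-true (a ≤? suc a) (ℕP.n≤1+n a)

∧-∨-true : ∀ e s x y → not e ∧ (s ∨ (x ∧ y)) ≡ true →
           s ≡ true ⊎ (e ≡ false × x ≡ true × y ≡ true)
∧-∨-true false true  _     _     _  = inj₁ refl
∧-∨-true false false true  true  _  = inj₂ (refl , refl , refl)
∧-∨-true false false true  false ()
∧-∨-true false false false _     ()
∧-∨-true true  _     _     _     ()

if-∧-false : ∀ {A : Set} b {x y : A} → (if b ∧ false then x else y) ≡ y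
if-∧-false true  = refl
if-∧-false false = refl

apart⇒¬consecutive : ∀ {a b} → suc a < b → ¬ (suc a ≡ b ⊎ suc b ≡ a)
apart⇒¬consecutive a+1<b =
  [ ℕP.<⇒≢ a+1<b , (λ b+1≡a → ℕP.<-asym (ℕP.<⇒≤ a+1<b) (ℕP.≤-reflexive b+1≡a)) ]

⊖-negative : ∀ {a b} → a < b → a ⊖ b ℤ.< 0ℤ
⊖-negative {a} a<b = ℤP.<-≤-trans (ℤP.⊖-monoʳ->-< a a<b) (ℤP.≤-reflexive (ℤP.n⊖n≡0 a))

foldr-tabulate : ∀ {A : Set} {N} (f : A → ℤ) (g : Fin N → A) →
                 foldr (λ u acc → f u + acc) 0ℤ (tabulate g) ≡ sum (f ∘ g)
foldr-tabulate {N = zero}  f g = refl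
foldr-tabulate {N = suc N} f g = cong (_+_ (f (g Fin.zero))) (foldr-tabulate f (g ∘ Fin.suc))

sum-mono-≤ : ∀ {N} {f g : Fin N → ℤ} → (∀ x → f x ℤ.≤ g x) → sum f ℤ.≤ sum g
sum-mono-≤ {zero}  f≤g = ℤP.≤-refl
sum-mono-≤ {suc N} f≤g = ℤP.+-mono-≤ (f≤g Fin.zero) (sum-mono-≤ (f≤g ∘ Fin.suc))

sum-const : ∀ p x → sum {p} (λ _ → x) ≡ + p ℤ.* x
sum-const zero    x = refl
sum-const (suc p) x = trans (cong (_+_ x) (sum-const p x)) (sym (ℤP.suc-* (+ p) x))

sum-≤-pred : ∀ {p} (f : Fin p → ℤ) c → f c ≡ 0ℤ → (∀ i → f i ℤ.≤ + 1) →
             sum f ℤ.≤ + (p ∸ 1)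
sum-≤-pred {suc p} f c fc≡0 f≤1 = begin
  sum f                    ≡⟨ sum-remove {i = c} f ⟩
  f c + sum (removeAt f c) ≡⟨ cong (_+ sum (removeAt f c)) fc≡0 ⟩
  0ℤ + sum (removeAt f c)  ≡⟨ ℤP.+-identityˡ _ ⟩
  sum (removeAt f c)       ≤⟨ sum-mono-≤ (f≤1 ∘ Fin.punchIn c) ⟩
  sum {p} (λ _ → + 1)      ≡⟨ sum-const p (+ 1) ⟩
  + p ℤ.* + 1              ≡⟨ ℤP.*-identityʳ (+ p) ⟩
  + p                      ∎
  where open ℤP.≤-Reasoning

sum-↑ : ∀ a b (f : Fin (a ℕ.+ b) → ℤ) → sum f ≡ sum (f ∘ (_↑ˡ b)) + sum (f ∘ (a ↑ʳ_))
sum-↑ zero    b f = sym (ℤP.+-identityˡ (sum f))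
sum-↑ (suc a) b f = trans (cong (_+_ (f Fin.zero)) (sum-↑ a b (f ∘ Fin.suc)))
                          (sym (ℤP.+-assoc (f Fin.zero) _ _))

sum-combine : ∀ n m (f : Fin (n ℕ.* m) → ℤ) → sum f ≡ sum {n} (λ i → sum {m} (λ a → f (combine i a)))
sum-combine zero    m f = refl
sum-combine (suc n) m f = trans (sum-↑ m (n ℕ.* m) f)
                                (cong (_+_ (sum (f ∘ (_↑ˡ n ℕ.* m)))) (sum-combine n m (f ∘ (m ↑ʳ_))))

sum-δ : ∀ {N} (c : Fin N) x → sum (λ j → if c == j then x else 0ℤ) ≡ x
sum-δ {suc N} Fin.zero    x = trans (cong (_+_ x) (sum-replicate-zero N)) (ℤP.+-identityʳ x)
sum-δ {suc N} (Fin.suc c) x = trans (ℤP.+-identityˡ _) (sum-δ c x)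

sum-δ-const : ∀ {n} m (c : Fin n) x →
              sum {n} (λ j → sum {m} (λ _ → if c == j then x else 0ℤ)) ≡ + m ℤ.* x
sum-δ-const {n} m c x = begin
  sum (λ j → sum {m} (λ _ → δ j)) ≡⟨ ∑-comm (λ j (_ : Fin m) → δ j) ⟩
  sum {m} (λ _ → sum δ)           ≡⟨ sum-cong-≗ {m} (λ _ → sum-δ c x) ⟩
  sum {m} (λ _ → x)               ≡⟨ sum-const m x ⟩
  + m ℤ.* x                       ∎
  where
  open ≡-Reasoning
  δ : Fin n → ℤ
  δ j = if c == j then x else 0ℤ

Φw-∷ʳ : ∀ {N} (w : List (Fin N)) v B → Φw (w ∷ʳ v) B ≡ Φ v (Φw w B)
Φw-∷ʳ []      v B = refl
Φw-∷ʳ (u ∷ w) v B = Φw-∷ʳ w v (Φ u B)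

module _ {N : ℕ} (v : Fin N) (B : BG N) where

  color-Φ-≢ : ∀ {u} → u ≢ v → color (Φ v B) u ≡ color B u
  color-Φ-≢ u≢v rewrite ==-≢ u≢v = refl

  color-Φ-self : color (Φ v B) v ≡ newColor (nbrSum B v) (color B v)
  color-Φ-self rewrite ==-refl v = refl

  adj-Φ : ∀ {x y p q e cx cy o} → adj B v x ≡ p → adj B v y ≡ q → (x == y) ≡ e →
          color B x ≡ cx → color B y ≡ cy → adj B x y ≡ o →
          adj (Φ v B) x y ≡ (if p ∧ q ∧ not e then sameColor cx cy else o)
  adj-Φ refl refl refl refl refl refl = refl

  adj-Φ-sym : ∀ {x y} → adj B y x ≡ adj B x y → adj (Φ v B) y x ≡ adj (Φ v B) x y
  adj-Φ-sym {x} {y} yx≡xy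
    rewrite yx≡xy | ==-sym y x | sameColor-sym (color B y) (color B x)
    with adj B v x | adj B v y
  ... | true  | true  = refl
  ... | true  | false = refl
  ... | false | true  = refl
  ... | false | false = refl

contribution : ∀ {N} → BG N → Fin N → Fin N → ℤ
contribution B v u = if adj B v u then colorVal (color B u) else 0ℤ

nbrSum-sum : ∀ {N} (B : BG N) v → nbrSum B v ≡ sum (contribution B v)
nbrSum-sum B v = foldr-tabulate (contribution B v) id

contribution-≡ : ∀ {N} (B : BG N) v u {b x} → adj B v u ≡ b → color B u ≡ x →
                 contribution B v u ≡ (if b then colorVal x else 0ℤ)
contribution-≡ B v u refl refl = refl

contribution-≤-1 : ∀ {N} (B : BG N) v u → contribution B v u ℤ.≤ + 1
contribution-≤-1 B v u with adj B v u | color B u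
... | true  | true  = ℤP.≤-refl
... | true  | false = ℤ.-≤+
... | false | _     = ℤ.+≤+ ℕ.z≤n

newColor-negative : ∀ {z} c → z ℤ.< 0ℤ → newColor z c ≡ false
newColor-negative { -[1+ _ ]} c _ = refl
newColor-negative {+ _}      c (ℤ.+<+ ())

-- Every comparison of I with k occurring in the stage descriptions is determined
-- by the position of I relative to k, so case analysis on a Position makes those
-- descriptions compute.
data Position (k I : ℕ) : Set where
  before   : suc I < k → Position k I
  previous : suc I ≡ k → Position k I
  current  : I ≡ k → Position k I
  after    : k < I → Position k I

position : ∀ k I → Position k I
position k I with ℕP.<-cmp (suc I) k
... | tri< I+1<k _ _ = before I+1<k
... | tri≈ _ I+1≡k _ = previous I+1≡k
... | tri> _ _ k<I+1 with ℕP.m≤n⇒m<n∨m≡n (ℕ.s≤s⁻¹ k<I+1)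
...   | inj₁ k<I = after k<I
...   | inj₂ k≡I = current (sym k≡I)

module _ {k I : ℕ} where

  k≤I k≤1+I 1+k≤I adjacentToCurrent isCurrent : Position k I → Bool
  k≤I (before _)   = false
  k≤I (previous _) = false
  k≤I (current _)  = true
  k≤I (after _)    = true

  k≤1+I (before _) = false
  k≤1+I _          = true

  1+k≤I (after _) = true
  1+k≤I _         = false

  adjacentToCurrent (previous _) = true
  adjacentToCurrent (after _)    = true
  adjacentToCurrent _            = false

  isCurrent (current _) = true
  isCurrent _           = false

  k≤I-correct : (p : Position k I) → does (k ≤? I) ≡ k≤I p
  k≤I-correct (before h)   = dec-false (k ≤? I) (ℕP.<⇒≱ (ℕP.<⇒≤ h))
  k≤I-correct (previous h) = dec-false (k ≤? I) (ℕP.<⇒≱ (ℕP.≤-reflexive h))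
  k≤I-correct (current h)  = dec-true (k ≤? I) (ℕP.≤-reflexive (sym h))
  k≤I-correct (after h)    = dec-true (k ≤? I) (ℕP.<⇒≤ h)

  k≤1+I-correct : (p : Position k I) → does (k ≤? suc I) ≡ k≤1+I p
  k≤1+I-correct (before h)   = dec-false (k ≤? suc I) (ℕP.<⇒≱ h)
  k≤1+I-correct (previous h) = dec-true (k ≤? suc I) (ℕP.≤-reflexive (sym h))
  k≤1+I-correct (current h)  = dec-true (k ≤? suc I) (ℕP.m≤n⇒m≤1+n (ℕP.≤-reflexive (sym h)))
  k≤1+I-correct (after h)    = dec-true (k ≤? suc I) (ℕP.m≤n⇒m≤1+n (ℕP.<⇒≤ h))

  1+k≤I-correct : (p : Position k I) → does (suc k ≤? I) ≡ 1+k≤I p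
  1+k≤I-correct (before h)   = dec-false (suc k ≤? I) (ℕP.<⇒≱ (ℕP.m<n⇒m<1+n (ℕP.<⇒≤ h)))
  1+k≤I-correct (previous h) = dec-false (suc k ≤? I) (ℕP.<⇒≱ (ℕP.m<n⇒m<1+n (ℕP.≤-reflexive h)))
  1+k≤I-correct (current h)  = dec-false (suc k ≤? I) (ℕP.<⇒≱ (ℕ.s≤s (ℕP.≤-reflexive h)))
  1+k≤I-correct (after h)    = dec-true (suc k ≤? I) h

  k≤I≡1+k≤I : (p : Position k I) → I ≢ k → k≤I p ≡ 1+k≤I p
  k≤I≡1+k≤I (before _)   _   = refl
  k≤I≡1+k≤I (previous _) _   = refl
  k≤I≡1+k≤I (current h)  I≢k = contradiction h I≢k
  k≤I≡1+k≤I (after _)    _   = refl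

module Flower (n m : ℕ) where

  private
    N : ℕ
    N = n ℕ.+ n ℕ.* m

  center-== : ∀ i j → (center {n} {m} i == center j) ≡ (i == j)
  center-== i j with i Fin.≟ j
  ... | yes refl = ==-refl (center {n} {m} i)
  ... | no i≢j   = ==-≢ (i≢j ∘ FinP.↑ˡ-injective (n ℕ.* m) i j)

  center≢petal : ∀ (i j : Fin n) (a : Fin m) → center i ≢ petal j a
  center≢petal i j a eq
    with trans (sym (FinP.splitAt-↑ˡ n i (n ℕ.* m)))
               (trans (cong (splitAt n) eq) (FinP.splitAt-↑ʳ n (n ℕ.* m) (combine j a)))
  ... | ()

  flowerColor-center : ∀ (i : Fin n) → flowerColor n m (center i) ≡ true
  flowerColor-center i rewrite FinP.splitAt-↑ˡ n i (n ℕ.* m) = refl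

  flowerColor-petal : ∀ (i : Fin n) (a : Fin m) → flowerColor n m (petal i a) ≡ false
  flowerColor-petal i a rewrite FinP.splitAt-↑ʳ n (n ℕ.* m) (combine i a) = refl

  flowerAdj-center-center : ∀ (i j : Fin n) → flowerAdj n m (center i) (center j) ≡ not (i == j)
  flowerAdj-center-center i j
    rewrite FinP.splitAt-↑ˡ n i (n ℕ.* m) | FinP.splitAt-↑ˡ n j (n ℕ.* m) = refl

  flowerAdj-center-petal : ∀ (i j : Fin n) (a : Fin m) → flowerAdj n m (center i) (petal j a) ≡ (i == j)
  flowerAdj-center-petal i j a
    rewrite FinP.splitAt-↑ˡ n i (n ℕ.* m) | FinP.splitAt-↑ʳ n (n ℕ.* m) (combine j a)
    = cong ((i ==_) ∘ proj₁) (FinP.remQuot-combine {n} {m} j a)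

  flowerAdj-petal-center : ∀ (i j : Fin n) (a : Fin m) → flowerAdj n m (petal j a) (center i) ≡ (j == i)
  flowerAdj-petal-center i j a
    rewrite FinP.splitAt-↑ˡ n i (n ℕ.* m) | FinP.splitAt-↑ʳ n (n ℕ.* m) (combine j a)
    = cong ((_== i) ∘ proj₁) (FinP.remQuot-combine {n} {m} j a)

  flowerAdj-petal-petal : ∀ (i : Fin n) (a : Fin m) j b →
                          flowerAdj n m (petal i a) (petal j b) ≡ (i == j) ∧ not (a == b)
  flowerAdj-petal-petal i a j b
    rewrite FinP.splitAt-↑ʳ n (n ℕ.* m) (combine i a) | FinP.splitAt-↑ʳ n (n ℕ.* m) (combine j b)
    = cong₂ (λ (i′ , a′) (j′ , b′) → (i′ == j′) ∧ not (a′ == b′))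
            (FinP.remQuot-combine {n} {m} i a) (FinP.remQuot-combine {n} {m} j b)

  consecutive? : (i j : Fin n) → Dec (suc (toℕ i) ≡ toℕ j ⊎ suc (toℕ j) ≡ toℕ i)
  consecutive? i j = (suc (toℕ i) ℕ.≟ toℕ j) ⊎-dec (suc (toℕ j) ℕ.≟ toℕ i)

  centerColor : ℕ → Fin n → Bool
  centerColor k i = does (k ≤? toℕ i)

  centerAdj : ℕ → Fin n → Fin n → Bool
  centerAdj k i j =
    not (i == j) ∧ (does (consecutive? i j) ∨ (does (k ≤? suc (toℕ i)) ∧ does (k ≤? suc (toℕ j))))

  centerPetalAdj : ℕ → Fin n → Fin n → Bool
  centerPetalAdj k i j = (i == j) ∨ (does (suc (toℕ i) ℕ.≟ toℕ j) ∧ not (does (k ≤? toℕ j)))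

  record IsStage (k : ℕ) (B : BG N) : Set where
    field
      color-center      : ∀ i → color B (center {m = m} i) ≡ centerColor k i
      color-petal       : ∀ (i : Fin n) (a : Fin m) → color B (petal i a) ≡ false
      adj-center-center : ∀ i j → adj B (center {m = m} i) (center j) ≡ centerAdj k i j
      adj-center-petal  : ∀ i j (a : Fin m) → adj B (center i) (petal j a) ≡ centerPetalAdj k i j
      adj-petal-center  : ∀ i j (a : Fin m) → adj B (petal j a) (center i) ≡ centerPetalAdj k i j
      adj-petal-petal   : ∀ (i : Fin n) (a : Fin m) j b →
                          adj B (petal i a) (petal j b) ≡ (i == j) ∧ not (a == b)

  stage-flower : IsStage 0 (flower n m)
  stage-flower = record
    { color-center      = flowerColor-center
    ; color-petal       = flowerColor-petal
    ; adj-center-center = λ i j → trans (flowerAdj-center-center i j) (sym (centerAdj-0 i j))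
    ; adj-center-petal  = λ i j a → trans (flowerAdj-center-petal i j a) (sym (centerPetalAdj-0 i j))
    ; adj-petal-center  = λ i j a → trans (flowerAdj-petal-center i j a)
                                          (trans (==-sym j i) (sym (centerPetalAdj-0 i j)))
    ; adj-petal-petal   = flowerAdj-petal-petal
    }
    where
    centerAdj-0 : ∀ i j → centerAdj 0 i j ≡ not (i == j)
    centerAdj-0 i j rewrite BoolP.∨-zeroʳ (does (consecutive? i j)) = BoolP.∧-identityʳ _
    centerPetalAdj-0 : ∀ i j → centerPetalAdj 0 i j ≡ (i == j)
    centerPetalAdj-0 i j rewrite BoolP.∧-zeroʳ (does (suc (toℕ i) ℕ.≟ toℕ j)) = BoolP.∨-identityʳ _

  centerAdj-≡ : ∀ k i j {e s x y} → (i == j) ≡ e → does (consecutive? i j) ≡ s →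
                does (k ≤? suc (toℕ i)) ≡ x → does (k ≤? suc (toℕ j)) ≡ y →
                centerAdj k i j ≡ not e ∧ (s ∨ (x ∧ y))
  centerAdj-≡ k i j refl refl refl refl = refl

  centerPetalAdj-≡ : ∀ k i j {e t u} → (i == j) ≡ e → does (suc (toℕ i) ℕ.≟ toℕ j) ≡ t →
                     does (k ≤? toℕ j) ≡ u → centerPetalAdj k i j ≡ e ∨ (t ∧ not u)
  centerPetalAdj-≡ k i j refl refl refl = refl

  centerAdj-self : ∀ k i → centerAdj k i i ≡ false
  centerAdj-self k i = centerAdj-≡ k i i (==-refl i) refl refl refl

  apart : ∀ {i j} → suc (toℕ i) < toℕ j ⊎ suc (toℕ j) < toℕ i →
          (i == j) ≡ false × does (consecutive? i j) ≡ false
  apart {i} {j} (inj₁ i+1<j) =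
      ==-toℕ-≢ (ℕP.<⇒≢ (ℕP.<⇒≤ i+1<j))
    , dec-false (consecutive? i j) (apart⇒¬consecutive i+1<j)
  apart {i} {j} (inj₂ j+1<i) =
      ==-toℕ-≢ (ℕP.>⇒≢ (ℕP.<⇒≤ j+1<i))
    , dec-false (consecutive? i j) (apart⇒¬consecutive j+1<i ∘ Sum.swap)

  module _ {k} {i j : Fin n} (pᵢ : Position k (toℕ i)) (pⱼ : Position k (toℕ j)) where

    centerAdj-position :
      centerAdj k i j ≡ not (i == j) ∧ (does (consecutive? i j) ∨ (k≤1+I pᵢ ∧ k≤1+I pⱼ))
    centerAdj-position = centerAdj-≡ k i j refl refl (k≤1+I-correct pᵢ) (k≤1+I-correct pⱼ)

    centerAdj-suc-position :
      centerAdj (suc k) i j ≡ not (i == j) ∧ (does (consecutive? i j) ∨ (k≤I pᵢ ∧ k≤I pⱼ))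
    centerAdj-suc-position =
      centerAdj-≡ (suc k) i j refl refl (trans (does-s≤s k (toℕ i)) (k≤I-correct pᵢ))
                                        (trans (does-s≤s k (toℕ j)) (k≤I-correct pⱼ))

    centerPetalAdj-position :
      centerPetalAdj k i j ≡ (i == j) ∨ (does (suc (toℕ i) ℕ.≟ toℕ j) ∧ not (k≤I pⱼ))
    centerPetalAdj-position = centerPetalAdj-≡ k i j refl refl (k≤I-correct pⱼ)

    centerPetalAdj-suc-position :
      centerPetalAdj (suc k) i j ≡ (i == j) ∨ (does (suc (toℕ i) ℕ.≟ toℕ j) ∧ not (1+k≤I pⱼ))
    centerPetalAdj-suc-position = centerPetalAdj-≡ (suc k) i j refl refl (1+k≤I-correct pⱼ)

  centerAdj-current : ∀ (c i : Fin n) (p : Position (toℕ c) (toℕ i)) →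
                      centerAdj (toℕ c) c i ≡ adjacentToCurrent p
  centerAdj-current c i (before i+1<c) =
    centerAdj-≡ (toℕ c) c i (proj₁ (apart (inj₂ i+1<c))) (proj₂ (apart (inj₂ i+1<c)))
                (does-n≤1+n (toℕ c)) (k≤1+I-correct (before i+1<c))
  centerAdj-current c i (previous i+1≡c) =
    centerAdj-≡ (toℕ c) c i (==-toℕ-≢ (ℕP.>⇒≢ (ℕP.≤-reflexive i+1≡c)))
                (dec-true (consecutive? c i) (inj₂ i+1≡c)) refl refl
  centerAdj-current c i (current i≡c) = centerAdj-≡ (toℕ c) c i (==-toℕ (sym i≡c)) refl refl refl
  centerAdj-current c i (after c<i) =
    trans (centerAdj-≡ (toℕ c) c i (==-toℕ-≢ (ℕP.<⇒≢ c<i)) refl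
                       (does-n≤1+n (toℕ c)) (k≤1+I-correct (after c<i)))
          (BoolP.∨-zeroʳ _)

  centerPetalAdj-processed : ∀ (c j : Fin n) → toℕ j < toℕ c → centerPetalAdj (toℕ c) c j ≡ false
  centerPetalAdj-processed c j j<c =
    centerPetalAdj-≡ (toℕ c) c j (==-toℕ-≢ (ℕP.>⇒≢ j<c))
      (dec-false (suc (toℕ c) ℕ.≟ toℕ j) (ℕP.>⇒≢ (ℕP.m<n⇒m<1+n j<c)))
      (dec-false (toℕ c ≤? toℕ j) (ℕP.<⇒≱ j<c))

  centerPetalAdj-current : ∀ (c j : Fin n) (p : Position (toℕ c) (toℕ j)) →
                           centerPetalAdj (toℕ c) c j ≡ isCurrent p
  centerPetalAdj-current c j (before j+1<c)   = centerPetalAdj-processed c j (ℕP.<⇒≤ j+1<c)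
  centerPetalAdj-current c j (previous j+1≡c) = centerPetalAdj-processed c j (ℕP.≤-reflexive j+1≡c)
  centerPetalAdj-current c j (current j≡c)    =
    centerPetalAdj-≡ (toℕ c) c j (==-toℕ (sym j≡c)) refl refl
  centerPetalAdj-current c j (after c<j)      =
    trans (centerPetalAdj-≡ (toℕ c) c j (==-toℕ-≢ (ℕP.<⇒≢ c<j)) refl (k≤I-correct (after c<j)))
          (BoolP.∧-zeroʳ _)

  isCurrent-== : ∀ (c j : Fin n) (p : Position (toℕ c) (toℕ j)) → isCurrent p ≡ (c == j)
  isCurrent-== c j (before j+1<c)   = sym (==-toℕ-≢ (ℕP.>⇒≢ (ℕP.<⇒≤ j+1<c)))
  isCurrent-== c j (previous j+1≡c) = sym (==-toℕ-≢ (ℕP.>⇒≢ (ℕP.≤-reflexive j+1≡c)))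
  isCurrent-== c j (current j≡c)    = sym (==-toℕ (sym j≡c))
  isCurrent-== c j (after c<j)      = sym (==-toℕ-≢ (ℕP.<⇒≢ c<j))

  centerPetalAdj-self : ∀ (c j : Fin n) → centerPetalAdj (toℕ c) c j ≡ (c == j)
  centerPetalAdj-self c j = trans (centerPetalAdj-current c j p) (isCurrent-== c j p)
    where p = position (toℕ c) (toℕ j)

  centerAdj-step : ∀ {k} {i j : Fin n} (pᵢ : Position k (toℕ i)) (pⱼ : Position k (toℕ j)) →
    (if adjacentToCurrent pᵢ ∧ adjacentToCurrent pⱼ ∧ not (i == j)
       then sameColor (k≤I pᵢ) (k≤I pⱼ)
       else not (i == j) ∧ (does (consecutive? i j) ∨ (k≤1+I pᵢ ∧ k≤1+I pⱼ)))
    ≡ not (i == j) ∧ (does (consecutive? i j) ∨ (k≤I pᵢ ∧ k≤I pⱼ))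
  centerAdj-step (before _)   _          = refl
  centerAdj-step (previous _) (before _) = refl
  centerAdj-step (current _)  (before _) = refl
  centerAdj-step (after _)    (before _) = refl
  centerAdj-step {i = i} {j} (previous i+1≡k) (previous j+1≡k)
    rewrite ==-toℕ {i = i} {j} (ℕP.suc-injective (trans i+1≡k (sym j+1≡k))) = refl
  centerAdj-step {i = i} {j} (previous i+1≡k) (current j≡k)
    rewrite dec-true (consecutive? i j) (inj₁ (trans i+1≡k (sym j≡k))) = refl
  centerAdj-step {i = i} {j} (current i≡k) (previous j+1≡k)
    rewrite dec-true (consecutive? i j) (inj₂ (trans j+1≡k (sym i≡k))) = refl
  centerAdj-step {i = i} {j} (previous i+1≡k) (after k<j)
    with apart {i} {j} (inj₁ (subst (_< toℕ j) (sym i+1≡k) k<j))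
  ... | i≠j , ¬consecutive rewrite i≠j | ¬consecutive = refl
  centerAdj-step {i = i} {j} (after k<i) (previous j+1≡k)
    with apart {i} {j} (inj₂ (subst (_< toℕ i) (sym j+1≡k) k<i))
  ... | i≠j , ¬consecutive rewrite i≠j | ¬consecutive = refl
  centerAdj-step (current _) (current _) = refl
  centerAdj-step (current _) (after _)   = refl
  centerAdj-step (after _)   (current _) = refl
  centerAdj-step {i = i} {j} (after _) (after _) with i == j
  ... | true  = refl
  ... | false = sym (BoolP.∨-zeroʳ _)

  centerPetalAdj-step : ∀ {k} {i j : Fin n} (pᵢ : Position k (toℕ i)) (pⱼ : Position k (toℕ j)) →
    (if adjacentToCurrent pᵢ ∧ isCurrent pⱼ ∧ not false
       then sameColor (k≤I pᵢ) false
       else (i == j) ∨ (does (suc (toℕ i) ℕ.≟ toℕ j) ∧ not (k≤I pⱼ)))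
    ≡ (i == j) ∨ (does (suc (toℕ i) ℕ.≟ toℕ j) ∧ not (1+k≤I pⱼ))
  centerPetalAdj-step pᵢ (before _)   = if-∧-false (adjacentToCurrent pᵢ)
  centerPetalAdj-step pᵢ (previous _) = if-∧-false (adjacentToCurrent pᵢ)
  centerPetalAdj-step pᵢ (after _)    = if-∧-false (adjacentToCurrent pᵢ)
  centerPetalAdj-step {i = i} {j} (before i+1<k) (current j≡k)
    rewrite dec-false (suc (toℕ i) ℕ.≟ toℕ j) (ℕP.<⇒≢ (subst (suc (toℕ i) <_) (sym j≡k) i+1<k))
    = refl
  centerPetalAdj-step {i = i} {j} (previous i+1≡k) (current j≡k)
    rewrite dec-true (suc (toℕ i) ℕ.≟ toℕ j) (trans i+1≡k (sym j≡k)) = sym (BoolP.∨-zeroʳ _)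
  centerPetalAdj-step {i = i} {j} (current i≡k) (current j≡k)
    rewrite ==-toℕ {i = i} {j} (trans i≡k (sym j≡k)) = refl
  centerPetalAdj-step {i = i} {j} (after k<i) (current j≡k)
    with subst (_< toℕ i) (sym j≡k) k<i
  ... | j<i rewrite ==-toℕ-≢ {i = i} {j} (ℕP.>⇒≢ j<i)
                  | dec-false (suc (toℕ i) ℕ.≟ toℕ j) (ℕP.>⇒≢ (ℕP.m<n⇒m<1+n j<i)) = refl

  petalAdj-step : ∀ {k} {i j : Fin n} {a b : Fin m} (pᵢ : Position k (toℕ i)) (pⱼ : Position k (toℕ j)) →
    (if isCurrent pᵢ ∧ isCurrent pⱼ ∧ not (petal i a == petal j b)
       then sameColor false false
       else (i == j) ∧ not (a == b))
    ≡ (i == j) ∧ not (a == b)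
  petalAdj-step (before _)   _            = refl
  petalAdj-step (previous _) _            = refl
  petalAdj-step (after _)    _            = refl
  petalAdj-step (current _)  (before _)   = refl
  petalAdj-step (current _)  (previous _) = refl
  petalAdj-step (current _)  (after _)    = refl
  petalAdj-step {i = i} {j} {a} {b} (current i≡k) (current j≡k)
    with FinP.toℕ-injective {i = i} {j} (trans i≡k (sym j≡k))
  ... | refl rewrite ==-refl i with a Fin.≟ b
  ...   | yes refl rewrite ==-refl (petal {n} {m} i a) = refl
  ...   | no _ with petal {n} {m} i a == petal i b
  ...     | true  = refl
  ...     | false = refl

  module _ (c : Fin n) {B : BG N} (stage : IsStage (toℕ c) B) where
    open IsStage stage

    private
      v : Fin N
      v = center c

      K : ℕ
      K = toℕ c

      t : Fin N → ℤ
      t = contribution B v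

      tCenter : Fin n → ℤ
      tCenter i = t (center i)

      tPetal : Fin (n ℕ.* m) → ℤ
      tPetal p = t (n ↑ʳ p)

      pos : (i : Fin n) → Position K (toℕ i)
      pos i = position K (toℕ i)

    sum-contribution-centers : sum tCenter ℤ.≤ + (n ∸ 1)
    sum-contribution-centers = sum-≤-pred tCenter c
      (contribution-≡ B v v (trans (adj-center-center c c) (centerAdj-self K c)) refl)
      (contribution-≤-1 B v ∘ center)

    sum-contribution-petals : sum tPetal ≡ ℤ.- (+ m)
    sum-contribution-petals = begin
      sum tPetal                                                 ≡⟨ sum-combine n m tPetal ⟩
      sum {n} (λ j → sum {m} (λ a → t (petal j a)))              ≡⟨ sum-cong-≗ (sum-cong-≗ ∘ t-petal) ⟩
      sum {n} (λ j → sum {m} (λ _ → if c == j then -1ℤ else 0ℤ)) ≡⟨ sum-δ-const m c -1ℤ ⟩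
      + m ℤ.* -1ℤ                                                ≡⟨ ℤP.*-comm (+ m) -1ℤ ⟩
      -1ℤ ℤ.* + m                                                ≡⟨ ℤP.-1*i≡-i (+ m) ⟩
      ℤ.- (+ m)                                                  ∎
      where
      open ≡-Reasoning
      t-petal : ∀ j a → t (petal j a) ≡ (if c == j then -1ℤ else 0ℤ)
      t-petal j a = contribution-≡ B v (petal j a)
                      (trans (adj-center-petal c j a) (centerPetalAdj-self c j)) (color-petal j a)

    nbrSum-current-negative : n ≤ m → nbrSum B v ℤ.< 0ℤ
    nbrSum-current-negative n≤m = begin-strict
      nbrSum B v               ≡⟨ nbrSum-sum B v ⟩
      sum t                    ≡⟨ sum-↑ n (n ℕ.* m) t ⟩
      sum tCenter + sum tPetal ≤⟨ ℤP.+-mono-≤ sum-contribution-centers (ℤP.≤-reflexive sum-contribution-petals) ⟩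
      + (n ∸ 1) + ℤ.- (+ m)    ≡⟨ ℤP.m-n≡m⊖n (n ∸ 1) m ⟩
      (n ∸ 1) ⊖ m              <⟨ ⊖-negative n∸1<m ⟩
      0ℤ                       ∎
      where
      open ℤP.≤-Reasoning
      n∸1<m : n ∸ 1 < m
      n∸1<m = ℕP.∸-monoˡ-< (ℕ.s≤s n≤m) (ℕP.≤-trans (ℕ.s≤s ℕ.z≤n) (FinP.toℕ<n c))

    private
      inN-center : ∀ i → adj B v (center i) ≡ adjacentToCurrent (pos i)
      inN-center i = trans (adj-center-center c i) (centerAdj-current c i (pos i))

      inN-petal : ∀ j (a : Fin m) → adj B v (petal j a) ≡ isCurrent (pos j)
      inN-petal j a = trans (adj-center-petal c j a) (centerPetalAdj-current c j (pos j))

      color-center-pos : ∀ i → color B (center i) ≡ k≤I (pos i)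
      color-center-pos i = trans (color-center i) (k≤I-correct (pos i))

    color-Φ-center : n ≤ m → ∀ i → color (Φ v B) (center i) ≡ centerColor (suc K) i
    color-Φ-center n≤m i with i Fin.≟ c
    ... | yes refl = trans (color-Φ-self v B)
                           (trans (newColor-negative _ (nbrSum-current-negative n≤m))
                                  (sym (dec-false (suc K ≤? K) ℕP.1+n≰n)))
    ... | no i≢c   = trans (color-Φ-≢ v B (i≢c ∘ FinP.↑ˡ-injective (n ℕ.* m) i c))
                           (trans (color-center-pos i)
                                  (trans (k≤I≡1+k≤I (pos i) (i≢c ∘ FinP.toℕ-injective))
                                         (sym (1+k≤I-correct (pos i)))))

    adj-Φ-center-center : ∀ i j → adj (Φ v B) (center i) (center j) ≡ centerAdj (suc K) i j
    adj-Φ-center-center i j =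
      trans (adj-Φ v B (inN-center i) (inN-center j) (center-== i j)
                       (color-center-pos i) (color-center-pos j)
                       (trans (adj-center-center i j) (centerAdj-position (pos i) (pos j))))
            (trans (centerAdj-step (pos i) (pos j)) (sym (centerAdj-suc-position (pos i) (pos j))))

    adj-Φ-center-petal : ∀ i j (a : Fin m) → adj (Φ v B) (center i) (petal j a) ≡ centerPetalAdj (suc K) i j
    adj-Φ-center-petal i j a =
      trans (adj-Φ v B (inN-center i) (inN-petal j a) (==-≢ (center≢petal i j a))
                       (color-center-pos i) (color-petal j a)
                       (trans (adj-center-petal i j a) (centerPetalAdj-position (pos i) (pos j))))
            (trans (centerPetalAdj-step (pos i) (pos j)) (sym (centerPetalAdj-suc-position (pos i) (pos j))))

    adj-Φ-petal-center : ∀ i j (a : Fin m) → adj (Φ v B) (petal j a) (center i) ≡ centerPetalAdj (suc K) i j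
    adj-Φ-petal-center i j a =
      trans (adj-Φ-sym v B (trans (adj-petal-center i j a) (sym (adj-center-petal i j a))))
            (adj-Φ-center-petal i j a)

    adj-Φ-petal-petal : ∀ i (a : Fin m) j b → adj (Φ v B) (petal i a) (petal j b) ≡ (i == j) ∧ not (a == b)
    adj-Φ-petal-petal i a j b =
      trans (adj-Φ v B (inN-petal i a) (inN-petal j b) refl (color-petal i a) (color-petal j b)
                       (adj-petal-petal i a j b))
            (petalAdj-step (pos i) (pos j))

    Φ-stage : n ≤ m → IsStage (suc K) (Φ v B)
    Φ-stage n≤m = record
      { color-center      = color-Φ-center n≤m
      ; color-petal       = λ i a → trans (color-Φ-≢ v B (center≢petal c i a ∘ sym)) (color-petal i a)
      ; adj-center-center = adj-Φ-center-center
      ; adj-center-petal  = adj-Φ-center-petal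
      ; adj-petal-center  = adj-Φ-petal-center
      ; adj-petal-petal   = adj-Φ-petal-petal
      }

  word1k-suc : (c : Fin n) → word1k n m (suc (toℕ c)) ≡ word1k n m (toℕ c) ∷ʳ center c
  word1k-suc c = trans (cong (map center) (ListP.take-suc-tabulate id c))
                       (ListP.map-++ center (take (toℕ c) (allFin n)) (c ∷ []))

  stage-word1k : n ≤ m → ∀ k → k ≤ n → IsStage k (Φw (word1k n m k) (flower n m))
  stage-word1k n≤m zero    _   = stage-flower
  stage-word1k n≤m (suc k) k<n =
    subst (λ k → IsStage (suc k) (Φw (word1k n m (suc k)) (flower n m))) (FinP.toℕ-fromℕ< k<n) stage-c
    where
    c = Fin.fromℕ< k<n
    stage-c : IsStage (suc (toℕ c)) (Φw (word1k n m (suc (toℕ c))) (flower n m))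
    stage-c rewrite word1k-suc c | Φw-∷ʳ (word1k n m (toℕ c)) (center c) (flower n m) =
      Φ-stage c (subst (λ k → IsStage k (Φw (word1k n m k) (flower n m))) (sym (FinP.toℕ-fromℕ< k<n))
                       (stage-word1k n≤m k (ℕP.<⇒≤ k<n)))
              n≤m

  centerColor-processed : ∀ {k} i → suc (toℕ i) ≤ k → centerColor k i ≡ false
  centerColor-processed {k} i i<k = dec-false (k ≤? toℕ i) (ℕP.<⇒≱ i<k)

  centerPetalAdj-successor : ∀ {k} i j → suc (toℕ i) < k → toℕ j ≡ suc (toℕ i) →
                             centerPetalAdj k i j ≡ true
  centerPetalAdj-successor {k} i j i+1<k j≡i+1 =
    trans (centerPetalAdj-≡ k i j refl (dec-true (suc (toℕ i) ℕ.≟ toℕ j) (sym j≡i+1))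
                            (dec-false (k ≤? toℕ j) (ℕP.<⇒≱ (subst (_< k) (sym j≡i+1) i+1<k))))
          (BoolP.∨-zeroʳ _)

  centerAdj-processed⇒consecutive : ∀ {k} i j → suc (toℕ i) ≤ k → suc (toℕ j) ≤ k →
    centerAdj k i j ≡ true → suc (toℕ i) ≡ toℕ j ⊎ suc (toℕ j) ≡ toℕ i
  centerAdj-processed⇒consecutive {k} i j i<k j<k adj≡true
    with ∧-∨-true (i == j) (does (consecutive? i j)) (does (k ≤? suc (toℕ i))) (does (k ≤? suc (toℕ j)))
                  adj≡true
  ... | inj₁ consecutive = does-true (consecutive? i j) consecutive
  ... | inj₂ (i≠j , k≤i+1 , k≤j+1) = contradiction (trans (sym i≠j) (==-toℕ i≡j)) λ ()
    where
    i≡j : toℕ i ≡ toℕ j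
    i≡j = ℕP.suc-injective (trans (ℕP.≤-antisym i<k (does-true (k ≤? suc (toℕ i)) k≤i+1))
                                  (ℕP.≤-antisym (does-true (k ≤? suc (toℕ j)) k≤j+1) j<k))

  consecutive⇒centerAdj : ∀ {k} i j → suc (toℕ i) ≡ toℕ j ⊎ suc (toℕ j) ≡ toℕ i →
                          centerAdj k i j ≡ true
  consecutive⇒centerAdj {k} i j consecutive =
    centerAdj-≡ k i j (==-toℕ-≢ i≢j) (dec-true (consecutive? i j) consecutive) refl refl
    where
    i≢j : toℕ i ≢ toℕ j
    i≢j = [ (λ i+1≡j i≡j → ℕP.1+n≢n (trans i+1≡j (sym i≡j)))
          , (λ j+1≡i i≡j → ℕP.1+n≢n (trans j+1≡i i≡j)) ] consecutive

  centerAdj-separated : ∀ {k} i j → suc (toℕ i) < k → k < suc (toℕ j) → centerAdj k i j ≡ false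
  centerAdj-separated {k} i j i+1<k k≤j =
    trans (centerAdj-≡ k i j refl (proj₂ (apart (inj₁ (ℕP.<-≤-trans i+1<k (ℕ.s≤s⁻¹ k≤j)))))
                       (dec-false (k ≤? suc (toℕ i)) (ℕP.<⇒≱ i+1<k)) refl)
          (BoolP.∧-zeroʳ _)

  centerAdj-clique : ∀ {k} i j → k ≤ suc (toℕ i) → k ≤ suc (toℕ j) → i ≢ j →
                     centerAdj k i j ≡ true
  centerAdj-clique {k} i j k≤i+1 k≤j+1 i≢j =
    trans (centerAdj-≡ k i j (==-≢ i≢j) refl
                       (dec-true (k ≤? suc (toℕ i)) k≤i+1) (dec-true (k ≤? suc (toℕ j)) k≤j+1))
          (BoolP.∨-zeroʳ _)

lemma1 : (n m : ℕ) → n ≤ m → (k : ℕ) → 0 < k → k ≤ n →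
    let F = flower n m
        B = Φw (word1k n m k) F
    in ((i : Fin n) → suc (toℕ i) ≤ k →
          color B (center i) ≡ not (color F (center i)))
     × ((i j : Fin n) → suc (toℕ i) < k → toℕ j ≡ suc (toℕ i) → (a : Fin m) →
          adj B (center i) (petal j a) ≡ true)
     × ((i j : Fin n) → suc (toℕ i) ≤ k → suc (toℕ j) ≤ k →
          ((adj B (center i) (center j) ≡ true) →
             (suc (toℕ i) ≡ toℕ j ⊎ suc (toℕ j) ≡ toℕ i))
          × ((suc (toℕ i) ≡ toℕ j ⊎ suc (toℕ j) ≡ toℕ i) →
             adj B (center i) (center j) ≡ true))
     × ((i j : Fin n) → suc (toℕ i) < k → k < suc (toℕ j) →
          adj B (center i) (center j) ≡ false)
     × ((i j : Fin n) → k ≤ suc (toℕ i) → k ≤ suc (toℕ j) → i ≢ j →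
          adj B (center i) (center j) ≡ true)
lemma1 n m n≤m k _ k≤n =
    (λ i i<k → trans (color-center i)
                     (trans (centerColor-processed i i<k) (sym (cong not (flowerColor-center i)))))
  , (λ i j i+1<k j≡i+1 a → trans (adj-center-petal i j a) (centerPetalAdj-successor i j i+1<k j≡i+1))
  , (λ i j i<k j<k → (centerAdj-processed⇒consecutive i j i<k j<k ∘ trans (sym (adj-center-center i j)))
                   , (trans (adj-center-center i j) ∘ consecutive⇒centerAdj {k} i j))
  , (λ i j i+1<k k≤j → trans (adj-center-center i j) (centerAdj-separated i j i+1<k k≤j))
  , (λ i j k≤i+1 k≤j+1 i≢j → trans (adj-center-center i j) (centerAdj-clique i j k≤i+1 k≤j+1 i≢j))
  where
  open Flower n m
  open IsStage (stage-word1k n≤m k k≤n)
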